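{- Let $\tau\in\mathfrak{S}(1243,2143)$ with $|\tau|\ge1$. Then $J_\tau(x) = G_\tau(x)$ if and only if the last entry of $\tau$ is $|\tau|$.
   Context: A subsequence has type $\sigma$ if it has the same relative order as $\sigma$; a permutation avoids $\sigma$ if it has no subsequence of type $\sigma$. $\mathfrak{S}(1243,2143)$ is the set of all permutations avoiding $1243$ and $2143$; $|\pi|$ is the length of $\pi$. For nonempty $\sigma$: $G_\sigma(x) = \sum x^{|\pi|}$ over $\pi\in\mathfrak{S}(1243,2143)$ containing exactly one subsequence of type $\sigma$; with $k = |\sigma|+1$ and $\sigma,k$ the permutation obtained by appending $k$ to $\sigma$, $J_\sigma(x) = \sum x^{|\pi|}$ over $\pi\in\mathfrak{S}(1243,2143)$ that avoid $\sigma,k$ and contain exactly one subsequence of type $\sigma$. -}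

module Defs where

open import Data.Bool using (Bool; true; false; _∧_; if_then_else_)
open import Data.Bool.Properties using () renaming (_≟_ to _≟ᵇ_)
open import Data.Nat using (ℕ; zero; suc; _<ᵇ_; _≡ᵇ_; _≤ᵇ_)
open import Data.List using (List; []; _∷_; _++_; [_]; map; concatMap; applyUpTo; length; filterᵇ)
open import Relation.Nullary.Decidable using (⌊_⌋)

-- Permutations of length n are lists of the values 1,...,n (one-line notation).

words : ℕ → ℕ → List (List ℕ)
words n zero    = [ [] ]
words n (suc k) = concatMap (λ w → map (λ a → a ∷ w) (applyUpTo suc n)) (words n k)

allᵇ : (ℕ → Bool) → List ℕ → Bool
allᵇ p []       = true
allᵇ p (x ∷ xs) = p x ∧ allᵇ p xs

distinctᵇ : List ℕ → Bool
distinctᵇ []       = true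
distinctᵇ (x ∷ xs) = allᵇ (λ y → if x ≡ᵇ y then false else true) xs ∧ distinctᵇ xs

isPermᵇ : List ℕ → Bool
isPermᵇ π = allᵇ (λ a → (1 ≤ᵇ a) ∧ (a ≤ᵇ length π)) π ∧ distinctᵇ π

perms : ℕ → List (List ℕ)
perms n = filterᵇ isPermᵇ (words n n)

-- All subsequences, taken by positions (so counted with multiplicity of position sets).
subseqs : List ℕ → List (List ℕ)
subseqs []       = [ [] ]
subseqs (x ∷ xs) = map (x ∷_) (subseqs xs) ++ subseqs xs

eqᵇ : Bool → Bool → Bool
eqᵇ a b = ⌊ a ≟ᵇ b ⌋

sameCmp : ℕ → ℕ → List ℕ → List ℕ → Bool
sameCmp x y (x' ∷ xs) (y' ∷ ys) =
  eqᵇ (x <ᵇ x') (y <ᵇ y') ∧ eqᵇ (x' <ᵇ x) (y' <ᵇ y) ∧ sameCmp x y xs ys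
sameCmp x y _ _ = true

sameOrder : List ℕ → List ℕ → Bool
sameOrder []       []       = true
sameOrder (x ∷ xs) (y ∷ ys) = sameCmp x y xs ys ∧ sameOrder xs ys
sameOrder _        _        = false

occ : List ℕ → List ℕ → ℕ
occ σ π = length (filterᵇ (λ s → sameOrder s σ) (subseqs π))

p1243 p2143 : List ℕ
p1243 = 1 ∷ 2 ∷ 4 ∷ 3 ∷ []
p2143 = 2 ∷ 1 ∷ 4 ∷ 3 ∷ []

inClassᵇ : List ℕ → Bool
inClassᵇ π = (occ p1243 π ≡ᵇ 0) ∧ (occ p2143 π ≡ᵇ 0)

extend : List ℕ → List ℕ
extend σ = σ ++ [ suc (length σ) ]

-- coefficient of x^n in G_σ(x)
Gcoeff : List ℕ → ℕ → ℕ
Gcoeff σ n = length (filterᵇ (λ π → inClassᵇ π ∧ (occ σ π ≡ᵇ 1)) (perms n))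

-- coefficient of x^n in J_σ(x)
Jcoeff : List ℕ → ℕ → ℕ
Jcoeff σ n = length (filterᵇ (λ π → inClassᵇ π ∧ (occ (extend σ) π ≡ᵇ 0) ∧ (occ σ π ≡ᵇ 1)) (perms n))

{-# OPTIONS --safe #-}
module Submission where

-- If the last entry of τ is its maximum |τ|, then every occurrence (p , a , b) of τ , |τ|+1 in a
-- permutation contains the occurrences (p , a) and (p , b) of τ: both a and b exceed every entry
-- of p, and they differ since a < b.  Hence a permutation containing τ exactly once avoids
-- τ , |τ|+1, and J_τ = G_τ.  If the last entry c of τ is not its maximum, consider
-- π₀ = τ , |τ|+1.  Appending a new maximum creates no occurrence of a pattern that does not end
-- with its own maximum; this applies to 1243, 2143 and τ, so π₀ lies in the class and contains
-- τ only once.  Since π₀ also contains τ , |τ|+1, it is counted by G_τ but not by J_τ.  That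
-- the last entry of a permutation is its maximum only if it equals the length is the
-- pigeonhole principle.

open import Defs
open import Data.Bool using (Bool; true; false; T; _∧_; if_then_else_)
open import Data.Bool.Properties using (T-≡; ∧-zeroʳ)
open import Data.Unit using (tt)
open import Data.Nat using (ℕ; zero; suc; _+_; _≤_; _<_; _≥_; z≤n; s≤s; _<ᵇ_; _≡ᵇ_; _≤ᵇ_)
open import Data.Nat.Properties
open import Data.List
  using (List; []; _∷_; _++_; [_]; _∷ʳ_; map; length; last; filter; filterᵇ; applyUpTo; initLast; _∷ʳ′_)
open import Data.List.Properties
  using (length-++; filter-++; filter-none; filter-all; filter-accept; filter-reject; filter-notAll; filter-≐;
         ∷ʳ-injective; ∷ʳ-injectiveʳ)
open import Data.List.Membership.Propositional using (_∈_)
open import Data.List.Membership.Propositional.Properties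
  using (∈-map⁺; ∈-map⁻; ∈-++⁺ˡ; ∈-++⁺ʳ; ∈-++⁻; ∈-applyUpTo⁺; ∈-concatMap⁺; ∈-filter⁺)
open import Data.List.Relation.Unary.Any using (here)
import Data.List.Relation.Unary.Any as Any
open import Data.List.Relation.Unary.All using (All; []; _∷_; all?)
import Data.List.Relation.Unary.All as All
import Data.List.Relation.Unary.All.Properties as All
open import Data.List.Relation.Unary.AllPairs using ([]; _∷_)
open import Data.List.Relation.Unary.Unique.Propositional using (Unique)
import Data.List.Relation.Unary.Unique.Propositional.Properties as Unique
open import Data.List.Relation.Binary.Pointwise using (Pointwise; []; _∷_)
import Data.List.Relation.Binary.Pointwise as Pointwise
import Data.List.Relation.Binary.Sublist.Propositional as Sublist
open Sublist using (_⊆_; []; _∷_; ⊆-refl; ⊆-trans)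
open import Data.List.Relation.Binary.Sublist.Propositional.Properties using (++⁺; ++⁺ʳ; All-resp-⊆; length-mono-≤)
open import Data.Maybe using (just)
open import Data.Maybe.Properties using (just-injective)
open import Data.Sum using (inj₁; inj₂)
open import Data.Product using (_×_; _,_; proj₁; proj₂; ∃₂)
import Data.Product as Product
open import Function using (_∘_)
open import Function.Bundles using (_⇔_; mk⇔; Equivalence)
open import Function.Construct.Composition using (_⇔-∘_)
open import Relation.Nullary using (¬_; yes; no; contradiction; ¬?)
open import Relation.Nullary.Decidable using (T?)
open import Relation.Binary.PropositionalEquality
  using (_≡_; _≢_; refl; sym; trans; cong; cong₂; subst; module ≡-Reasoning)
open import Algebra.Properties.CommutativeSemigroup +-commutativeSemigroup using (interchange)

open Equivalence using (to; from)

variable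
  A : Set
  x y w z a c d k : ℕ
  xs ys s σ π : List ℕ

∧-split : ∀ u {v} → T (u ∧ v) → T u × T v
∧-split true t = tt , t

∧-pair : ∀ u {v} → T u → T v → T (u ∧ v)
∧-pair true _ t = t

eqᵇ-∧⁻ : ∀ u v {r} → T (eqᵇ u v ∧ r) → u ≡ v × T r
eqᵇ-∧⁻ false false t = refl , t
eqᵇ-∧⁻ true  true  t = refl , t

eqᵇ-∧⁺ : ∀ {u v r} → u ≡ v → T r → T (eqᵇ u v ∧ r)
eqᵇ-∧⁺ {false} refl t = t
eqᵇ-∧⁺ {true}  refl t = t

count : (A → Bool) → List A → ℕ
count P xs = length (filterᵇ P xs)

count-++ : ∀ (P : A → Bool) xs ys → count P (xs ++ ys) ≡ count P xs + count P ys
count-++ P xs ys = trans (cong length (filter-++ (T? ∘ P) xs ys)) (length-++ (filterᵇ P xs))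

count-map : ∀ {B : Set} (P : B → Bool) (f : A → B) xs → count P (map f xs) ≡ count (P ∘ f) xs
count-map P f []       = refl
count-map P f (x ∷ xs) with P (f x)
... | true  = cong suc (count-map P f xs)
... | false = count-map P f xs

count-cong : ∀ {P Q : A → Bool} → (∀ x → P x ≡ Q x) → ∀ xs → count P xs ≡ count Q xs
count-cong {P = P} {Q} P≗Q xs =
  cong length (filter-≐ (T? ∘ P) (T? ∘ Q) ((λ {x} → subst T (P≗Q x)) , (λ {x} → subst T (sym (P≗Q x)))) xs)

count-none : ∀ (P : A → Bool) {xs} → (∀ {x} → x ∈ xs → ¬ T (P x)) → count P xs ≡ 0
count-none P none = cong length (filter-none (T? ∘ P) (All.tabulate none))

count≡1⇒unique : ∀ {P : A → Bool} {xs u v} → count P xs ≡ 1 →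
  u ∈ xs → T (P u) → v ∈ xs → T (P v) → u ≡ v
count≡1⇒unique {P = P} {xs} count≡1 u∈ Pu v∈ Pv
  with filterᵇ P xs | ∈-filter⁺ (T? ∘ P) u∈ Pu | ∈-filter⁺ (T? ∘ P) v∈ Pv
... | _ ∷ [] | here refl | here refl = refl

filterᵇ-absorb : ∀ {P Q : A → Bool} → (∀ {x} → T (P x) → T (Q x)) →
  ∀ xs → filterᵇ P (filterᵇ Q xs) ≡ filterᵇ P xs
filterᵇ-absorb P⇒Q [] = refl
filterᵇ-absorb {P = P} {Q} P⇒Q (x ∷ xs) with Q x in Qx
... | true with P x
...   | true  = cong (x ∷_) (filterᵇ-absorb P⇒Q xs)
...   | false = filterᵇ-absorb P⇒Q xs
filterᵇ-absorb {P = P} {Q} P⇒Q (x ∷ xs) | false with P x in Px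
...   | true  = contradiction (P⇒Q (subst T (sym Px) tt)) (subst T Qx)
...   | false = filterᵇ-absorb P⇒Q xs

count-< : ∀ {P Q : A → Bool} {xs u} → (∀ {x} → T (P x) → T (Q x)) →
  u ∈ xs → T (Q u) → ¬ T (P u) → count P xs < count Q xs
count-< {P = P} {Q} {xs} P⇒Q u∈ Qu ¬Pu = begin-strict
  count P xs              ≡⟨ cong length (filterᵇ-absorb P⇒Q xs) ⟨
  count P (filterᵇ Q xs)  <⟨ filter-notAll (T? ∘ P) _ (Any.map (λ { refl → ¬Pu }) (∈-filter⁺ (T? ∘ Q) u∈ Qu)) ⟩
  count Q xs              ∎
  where open ≤-Reasoning

-- Subsequences

∈-subseqs⁻ : ∀ π → s ∈ subseqs π → s ⊆ π
∈-subseqs⁻ []      (here refl) = []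
∈-subseqs⁻ (x ∷ π) s∈ with ∈-++⁻ (map (x ∷_) (subseqs π)) s∈
... | inj₁ s∈map with s′ , s′∈ , refl ← ∈-map⁻ (x ∷_) s∈map = refl ∷ ∈-subseqs⁻ π s′∈
... | inj₂ s∈π = x Sublist.∷ʳ ∈-subseqs⁻ π s∈π

∈-subseqs⁺ : s ⊆ π → s ∈ subseqs π
∈-subseqs⁺ []                 = here refl
∈-subseqs⁺ (_ Sublist.∷ʳ s⊆π) = ∈-++⁺ʳ _ (∈-subseqs⁺ s⊆π)
∈-subseqs⁺ (refl ∷ s⊆π)       = ∈-++⁺ˡ (∈-map⁺ _ (∈-subseqs⁺ s⊆π))

subseqs-⊆-closed : ∀ π → xs ⊆ ys → ys ∈ subseqs π → xs ∈ subseqs π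
subseqs-⊆-closed π xs⊆ys ys∈ = ∈-subseqs⁺ (⊆-trans xs⊆ys (∈-subseqs⁻ π ys∈))

subseqs-∷-count : ∀ (P : List ℕ → Bool) x xs →
  count P (subseqs (x ∷ xs)) ≡ count (P ∘ (x ∷_)) (subseqs xs) + count P (subseqs xs)
subseqs-∷-count P x xs =
  trans (count-++ P (map (x ∷_) (subseqs xs)) (subseqs xs))
        (cong (_+ count P (subseqs xs)) (count-map P (x ∷_) (subseqs xs)))

subseqs-∷ʳ-count : ∀ (P : List ℕ → Bool) xs k →
  count P (subseqs (xs ∷ʳ k)) ≡ count (P ∘ (_∷ʳ k)) (subseqs xs) + count P (subseqs xs)
subseqs-∷ʳ-count P [] k with P [ k ]
... | true  = refl
... | false = refl
subseqs-∷ʳ-count P (x ∷ xs) k = begin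
  count P (subseqs (x ∷ xs ∷ʳ k))
    ≡⟨ subseqs-∷-count P x (xs ∷ʳ k) ⟩
  count (P ∘ (x ∷_)) (subseqs (xs ∷ʳ k)) + count P (subseqs (xs ∷ʳ k))
    ≡⟨ cong₂ _+_ (subseqs-∷ʳ-count (P ∘ (x ∷_)) xs k) (subseqs-∷ʳ-count P xs k) ⟩
  (N (P ∘ (x ∷_) ∘ (_∷ʳ k)) + N (P ∘ (x ∷_))) + (N (P ∘ (_∷ʳ k)) + N P)
    ≡⟨ interchange (N (P ∘ (x ∷_) ∘ (_∷ʳ k))) (N (P ∘ (x ∷_))) (N (P ∘ (_∷ʳ k))) (N P) ⟩
  (N (P ∘ (x ∷_) ∘ (_∷ʳ k)) + N (P ∘ (_∷ʳ k))) + (N (P ∘ (x ∷_)) + N P)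
    ≡⟨ cong₂ _+_ (subseqs-∷-count (P ∘ (_∷ʳ k)) x xs) (subseqs-∷-count P x xs) ⟨
  count (P ∘ (_∷ʳ k)) (subseqs (x ∷ xs)) + count P (subseqs (x ∷ xs))
    ∎
  where
  open ≡-Reasoning
  N : (List ℕ → Bool) → ℕ
  N Q = count Q (subseqs xs)

subseqs-count-self : ∀ (P : List ℕ → Bool) xs → (∀ {s} → T (P s) → length s ≡ length xs) →
  T (P xs) → count P (subseqs xs) ≡ 1
subseqs-count-self P [] _ Pxs with P []
... | true = refl
subseqs-count-self P (x ∷ xs) full Pxs = begin
  count P (subseqs (x ∷ xs))                              ≡⟨ subseqs-∷-count P x xs ⟩
  count (P ∘ (x ∷_)) (subseqs xs) + count P (subseqs xs)  ≡⟨ cong₂ _+_ tails-once shorter-never ⟩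
  1                                                       ∎
  where
  open ≡-Reasoning
  tails-once : count (P ∘ (x ∷_)) (subseqs xs) ≡ 1
  tails-once = subseqs-count-self (P ∘ (x ∷_)) xs (suc-injective ∘ full) Pxs
  shorter-never : count P (subseqs xs) ≡ 0
  shorter-never = count-none P λ s∈ Ps → <-irrefl (full Ps) (s≤s (length-mono-≤ (∈-subseqs⁻ xs s∈)))

-- Order isomorphism

data Alike (x y w z : ℕ) : Set where
  alike : (x <ᵇ w) ≡ (y <ᵇ z) → (w <ᵇ x) ≡ (z <ᵇ y) → Alike x y w z

data SameOrder : List ℕ → List ℕ → Set where
  []  : SameOrder [] []
  _∷_ : Pointwise (Alike x y) xs ys → SameOrder xs ys → SameOrder (x ∷ xs) (y ∷ ys)

SameOrder-length : SameOrder s σ → length s ≡ length σ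
SameOrder-length []       = refl
SameOrder-length (_ ∷ so) = cong suc (SameOrder-length so)

SameOrder-refl : ∀ σ → SameOrder σ σ
SameOrder-refl []      = []
SameOrder-refl (x ∷ σ) = Pointwise.refl (alike refl refl) ∷ SameOrder-refl σ

sameCmp⇒Pointwise : length xs ≡ length ys → T (sameCmp x y xs ys) → Pointwise (Alike x y) xs ys
sameCmp⇒Pointwise {[]}     {[]}             _  _ = []
sameCmp⇒Pointwise {w ∷ xs} {z ∷ ys} {x} {y} eq t =
  let e₁ , t₁ = eqᵇ-∧⁻ (x <ᵇ w) (y <ᵇ z) t
      e₂ , t₂ = eqᵇ-∧⁻ (w <ᵇ x) (z <ᵇ y) t₁
  in alike e₁ e₂ ∷ sameCmp⇒Pointwise (suc-injective eq) t₂

Pointwise⇒sameCmp : Pointwise (Alike x y) xs ys → T (sameCmp x y xs ys)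
Pointwise⇒sameCmp []                 = tt
Pointwise⇒sameCmp (alike e₁ e₂ ∷ rs) = eqᵇ-∧⁺ e₁ (eqᵇ-∧⁺ e₂ (Pointwise⇒sameCmp rs))

sameOrder⇒SameOrder : ∀ s σ → T (sameOrder s σ) → SameOrder s σ
sameOrder⇒SameOrder []      []      _ = []
sameOrder⇒SameOrder (x ∷ s) (y ∷ σ) t =
  let cmp , rest = ∧-split (sameCmp x y s σ) t
      so = sameOrder⇒SameOrder s σ rest
  in sameCmp⇒Pointwise (SameOrder-length so) cmp ∷ so

SameOrder⇒sameOrder : SameOrder s σ → T (sameOrder s σ)
SameOrder⇒sameOrder []                        = tt
SameOrder⇒sameOrder {x ∷ s} {y ∷ σ} (rs ∷ so) =
  ∧-pair (sameCmp x y s σ) (Pointwise⇒sameCmp rs) (SameOrder⇒sameOrder so)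

Pointwise-∷ʳ⁻ : ∀ {R : ℕ → ℕ → Set} → length xs ≡ length ys →
  Pointwise R (xs ∷ʳ a) (ys ∷ʳ c) → Pointwise R xs ys × R a c
Pointwise-∷ʳ⁻ {[]}    {[]}    _  (r ∷ []) = [] , r
Pointwise-∷ʳ⁻ {_ ∷ _} {_ ∷ _} eq (r ∷ rs) = Product.map₁ (r ∷_) (Pointwise-∷ʳ⁻ (suc-injective eq) rs)

Pointwise-last-map : ∀ {R : ℕ → ℕ → Set} → (∀ {w} → R w d → R w c) →
  Pointwise R s (σ ∷ʳ d) → Pointwise R s (σ ∷ʳ c)
Pointwise-last-map {σ = []}    f (r ∷ []) = f r ∷ []
Pointwise-last-map {σ = _ ∷ σ} f (r ∷ rs) = r ∷ Pointwise-last-map {σ = σ} f rs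

Pointwise-All : ∀ {R : ℕ → ℕ → Set} {P Q : ℕ → Set} → (∀ {w z} → R w z → P w → Q z) →
  Pointwise R xs ys → All P xs → All Q ys
Pointwise-All f []       []         = []
Pointwise-All f (r ∷ rs) (px ∷ pxs) = f r px ∷ Pointwise-All f rs pxs

SameOrder-∷ʳ⁻ : ∀ σ → SameOrder s (σ ∷ʳ c) →
  ∃₂ λ p a → s ≡ p ∷ʳ a × SameOrder p σ × Pointwise (λ w z → Alike w z a c) p σ
SameOrder-∷ʳ⁻ []      ([] ∷ []) = [] , _ , refl , [] , []
SameOrder-∷ʳ⁻ (y ∷ σ) (rs ∷ so) with SameOrder-∷ʳ⁻ σ so
... | p , a , refl , so′ , rs′ =
  let rsᵖ , r = Pointwise-∷ʳ⁻ (SameOrder-length so′) rs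
  in _ ∷ p , a , refl , rsᵖ ∷ so′ , r ∷ rs′

SameOrder-∷ʳ⁺ : SameOrder s σ → Pointwise (λ w z → Alike w z a c) s σ → SameOrder (s ∷ʳ a) (σ ∷ʳ c)
SameOrder-∷ʳ⁺ []        []        = [] ∷ []
SameOrder-∷ʳ⁺ (rs ∷ so) (r ∷ rs′) = Pointwise.++⁺ rs (r ∷ []) ∷ SameOrder-∷ʳ⁺ so rs′

<ᵇ-true : x < y → (x <ᵇ y) ≡ true
<ᵇ-true = to T-≡ ∘ <⇒<ᵇ

<ᵇ-false : y ≤ x → (x <ᵇ y) ≡ false
<ᵇ-false {y} {x} y≤x with x <ᵇ y in e
... | true  = contradiction y≤x (<⇒≱ (<ᵇ⇒< x y (subst T (sym e) tt)))
... | false = refl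

Alike-sym : Alike x y w z → Alike y x z w
Alike-sym (alike e₁ e₂) = alike (sym e₁) (sym e₂)

Alike-< : Alike w z a c → w < a → z < c
Alike-< {w} {z} {a} {c} (alike e _) w<a = <ᵇ⇒< z c (subst T e (<⇒<ᵇ w<a))

Alike-raise : y < c → y < d → Alike x y w d → Alike x y w c
Alike-raise y<c y<d (alike e₁ e₂) =
  alike (trans e₁ (trans (<ᵇ-true y<d) (sym (<ᵇ-true y<c))))
        (trans e₂ (trans (<ᵇ-false (<⇒≤ y<d)) (sym (<ᵇ-false (<⇒≤ y<c)))))

SameOrder-last-max : ∀ σ → SameOrder (s ∷ʳ k) (σ ∷ʳ c) → All (_< k) s → All (_< c) σ
SameOrder-last-max {s} σ so s<k with SameOrder-∷ʳ⁻ σ so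
... | p , a , eq , _ , rs with refl , refl ← ∷ʳ-injective s p eq = Pointwise-All Alike-< rs s<k

SameOrder-replace-last-max : All (_< c) σ → All (_< d) σ → SameOrder s (σ ∷ʳ d) → SameOrder s (σ ∷ʳ c)
SameOrder-replace-last-max []          []          ([] ∷ [])  = [] ∷ []
SameOrder-replace-last-max (y<c ∷ σ<c) (y<d ∷ σ<d) (rs ∷ so) =
  Pointwise-last-map (Alike-raise y<c y<d) rs ∷ SameOrder-replace-last-max σ<c σ<d so

-- Occurrences

occ-self : ∀ σ → occ σ σ ≡ 1
occ-self σ = subseqs-count-self _ σ (λ {s} t → SameOrder-length (sameOrder⇒SameOrder s σ t))
                                    (SameOrder⇒sameOrder (SameOrder-refl σ))

occ-∷ʳ-max : ∀ ρ π → All (_< k) π → ¬ All (_< c) ρ → occ (ρ ∷ʳ c) (π ∷ʳ k) ≡ occ (ρ ∷ʳ c) π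
occ-∷ʳ-max {k} {c} ρ π π<k ¬ρ<c = begin
  occ (ρ ∷ʳ c) (π ∷ʳ k)
    ≡⟨ subseqs-∷ʳ-count _ π k ⟩
  count (λ s → sameOrder (s ∷ʳ k) (ρ ∷ʳ c)) (subseqs π) + occ (ρ ∷ʳ c) π
    ≡⟨ cong (_+ occ (ρ ∷ʳ c) π) (count-none _ ending-in-k) ⟩
  occ (ρ ∷ʳ c) π
    ∎
  where
  open ≡-Reasoning
  ending-in-k : s ∈ subseqs π → ¬ T (sameOrder (s ∷ʳ k) (ρ ∷ʳ c))
  ending-in-k s∈ t = ¬ρ<c (SameOrder-last-max ρ (sameOrder⇒SameOrder _ _ t) (All-resp-⊆ (∈-subseqs⁻ π s∈) π<k))

unique-occurrence⇒avoids-extension : ∀ ρ π → All (_< c) ρ → c < d →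
  occ (ρ ∷ʳ c) π ≡ 1 → occ ((ρ ∷ʳ c) ∷ʳ d) π ≡ 0
unique-occurrence⇒avoids-extension {c} {d} ρ π ρ<c c<d occ≡1 = count-none _ no-occurrence
  where
  no-occurrence : s ∈ subseqs π → ¬ T (sameOrder s ((ρ ∷ʳ c) ∷ʳ d))
  no-occurrence {s} s∈ t with SameOrder-∷ʳ⁻ (ρ ∷ʳ c) (sameOrder⇒SameOrder s _ t)
  ... | _ , b , refl , so-pa , rs-b with SameOrder-∷ʳ⁻ ρ so-pa
  ... | p , a , refl , so-p , _ with Pointwise-∷ʳ⁻ (SameOrder-length so-p) rs-b
  ... | rs-pb , a~b = <⇒≢ a<b (∷ʳ-injectiveʳ p p pa≡pb)
    where
    a<b : a < b
    a<b = Alike-< (Alike-sym a~b) c<d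
    ρ<d : All (_< d) ρ
    ρ<d = All.map (λ z<c → <-trans z<c c<d) ρ<c
    so-pb : SameOrder (p ∷ʳ b) (ρ ∷ʳ c)
    so-pb = SameOrder-replace-last-max ρ<c ρ<d (SameOrder-∷ʳ⁺ so-p rs-pb)
    pa∈ : p ∷ʳ a ∈ subseqs π
    pa∈ = subseqs-⊆-closed π (++⁺ʳ [ b ] ⊆-refl) s∈
    pb∈ : p ∷ʳ b ∈ subseqs π
    pb∈ = subseqs-⊆-closed π (++⁺ (++⁺ʳ [ a ] (⊆-refl {x = p})) (⊆-refl {x = [ b ]})) s∈
    pa≡pb : p ∷ʳ a ≡ p ∷ʳ b
    pa≡pb = count≡1⇒unique occ≡1 pa∈ (SameOrder⇒sameOrder so-pa) pb∈ (SameOrder⇒sameOrder so-pb)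

-- Permutations

InRange : ℕ → ℕ → Set
InRange n a = 1 ≤ a × a ≤ n

allᵇ⁻ : ∀ (P : ℕ → Bool) xs → T (allᵇ P xs) → All (T ∘ P) xs
allᵇ⁻ P []       _ = []
allᵇ⁻ P (x ∷ xs) t = let Px , Pxs = ∧-split (P x) t in Px ∷ allᵇ⁻ P xs Pxs

allᵇ⁺ : ∀ (P : ℕ → Bool) {xs} → All (T ∘ P) xs → T (allᵇ P xs)
allᵇ⁺ P []                 = tt
allᵇ⁺ P {x ∷ _} (Px ∷ Pxs) = ∧-pair (P x) Px (allᵇ⁺ P Pxs)

-- Spelled as in distinctᵇ, so that the two agree definitionally.
differentᵇ : ℕ → ℕ → Bool
differentᵇ x y = if x ≡ᵇ y then false else true

differentᵇ⇒≢ : ∀ x y → T (differentᵇ x y) → x ≢ y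
differentᵇ⇒≢ x .x t refl = subst (λ u → T (if u then false else true)) (to T-≡ (≡⇒≡ᵇ x x refl)) t

≢⇒differentᵇ : x ≢ y → T (differentᵇ x y)
≢⇒differentᵇ {x} {y} x≢y with x ≡ᵇ y in e
... | true  = x≢y (≡ᵇ⇒≡ x y (from T-≡ e))
... | false = tt

distinctᵇ⁻ : ∀ xs → T (distinctᵇ xs) → Unique xs
distinctᵇ⁻ []       _ = []
distinctᵇ⁻ (x ∷ xs) t =
  let fresh , rest = ∧-split (allᵇ (differentᵇ x) xs) t
  in All.map (differentᵇ⇒≢ x _) (allᵇ⁻ (differentᵇ x) xs fresh) ∷ distinctᵇ⁻ xs rest

distinctᵇ⁺ : Unique xs → T (distinctᵇ xs)
distinctᵇ⁺ []                   = tt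
distinctᵇ⁺ {x ∷ xs} (fresh ∷ u) =
  ∧-pair (allᵇ (differentᵇ x) xs) (allᵇ⁺ (differentᵇ x) (All.map ≢⇒differentᵇ fresh)) (distinctᵇ⁺ u)

isPermᵇ⁻ : ∀ π → T (isPermᵇ π) → All (InRange (length π)) π × Unique π
isPermᵇ⁻ π t =
  let range , distinct = ∧-split (allᵇ _ π) t
      inRange = λ {a} t → Product.map (≤ᵇ⇒≤ 1 a) (≤ᵇ⇒≤ a _) (∧-split (1 ≤ᵇ a) t)
  in All.map inRange (allᵇ⁻ _ π range) , distinctᵇ⁻ π distinct

isPermᵇ⁺ : All (InRange (length π)) π → Unique π → T (isPermᵇ π)
isPermᵇ⁺ {π} range u = ∧-pair (allᵇ _ π) (allᵇ⁺ _ (All.map inRangeᵇ range)) (distinctᵇ⁺ u)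
  where
  inRangeᵇ : ∀ {a} → InRange (length π) a → T ((1 ≤ᵇ a) ∧ (a ≤ᵇ length π))
  inRangeᵇ {a} (1≤a , a≤n) = ∧-pair (1 ≤ᵇ a) (≤⇒≤ᵇ 1≤a) (≤⇒≤ᵇ a≤n)

Unique-∷ʳ⁺ : Unique xs → All (_≢ x) xs → Unique (xs ∷ʳ x)
Unique-∷ʳ⁺ []          []           = [] ∷ []
Unique-∷ʳ⁺ (fresh ∷ u) (y≢x ∷ xs≢x) = All.∷ʳ⁺ fresh y≢x ∷ Unique-∷ʳ⁺ u xs≢x

Unique-∷ʳ⁻ : ∀ xs → Unique (xs ∷ʳ x) → All (_≢ x) xs
Unique-∷ʳ⁻ []       _           = []
Unique-∷ʳ⁻ (y ∷ xs) (fresh ∷ u) = proj₂ (All.∷ʳ⁻ fresh) ∷ Unique-∷ʳ⁻ xs u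

without : ℕ → List ℕ → List ℕ
without v = filter (λ a → ¬? (a ≟ v))

length-without : ∀ v {xs} → Unique xs → length xs ≤ suc (length (without v xs))
length-without v [] = z≤n
length-without v {x ∷ xs} (fresh ∷ u) with x ≟ v
... | yes refl rewrite filter-reject (λ a → ¬? (a ≟ x)) {x} {xs} (λ x≢x → x≢x refl) =
  s≤s (≤-reflexive (cong length (sym (filter-all (λ a → ¬? (a ≟ x)) (All.map (λ x≢a → x≢a ∘ sym) fresh)))))
... | no x≢v rewrite filter-accept (λ a → ¬? (a ≟ v)) {x} {xs} x≢v = s≤s (length-without v u)

pigeonhole : ∀ n {xs} → Unique xs → All (InRange n) xs → length xs ≤ n
pigeonhole zero    {[]}    _ _                 = z≤n
pigeonhole zero    {_ ∷ _} _ ((1≤x , x≤0) ∷ _) = contradiction (≤-trans 1≤x x≤0) λ ()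
pigeonhole (suc n) {xs}    u range             =
  ≤-trans (length-without (suc n) u) (s≤s (pigeonhole n unique′ range′))
  where
  unique′ : Unique (without (suc n) xs)
  unique′ = Unique.filter⁺ _ u
  lower : ∀ {a} → InRange (suc n) a × a ≢ suc n → InRange n a
  lower ((1≤a , a≤1+n) , a≢1+n) = 1≤a , m<1+n⇒m≤n (≤∧≢⇒< a≤1+n a≢1+n)
  range′ : All (InRange n) (without (suc n) xs)
  range′ = All.zipWith lower (All.filter⁺ _ range , All.all-filter _ xs)

last-max⇔last≡length : ∀ ρ → All (InRange (length (ρ ∷ʳ c))) (ρ ∷ʳ c) × Unique (ρ ∷ʳ c) →
  All (_< c) ρ ⇔ c ≡ length (ρ ∷ʳ c)
last-max⇔last≡length {c} ρ (range , u) = mk⇔ last≡length last-max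
  where
  ρ-range : All (InRange (length (ρ ∷ʳ c))) ρ
  ρ-range = proj₁ (All.∷ʳ⁻ range)
  c-range : InRange (length (ρ ∷ʳ c)) c
  c-range = proj₂ (All.∷ʳ⁻ range)
  last≡length : All (_< c) ρ → c ≡ length (ρ ∷ʳ c)
  last≡length ρ<c = ≤-antisym (proj₂ c-range) (pigeonhole c u (All.∷ʳ⁺ ρ-below-c (proj₁ c-range , ≤-refl)))
    where
    ρ-below-c : All (InRange c) ρ
    ρ-below-c = All.zipWith (λ ((1≤a , _) , a<c) → 1≤a , <⇒≤ a<c) (ρ-range , ρ<c)
  last-max : c ≡ length (ρ ∷ʳ c) → All (_< c) ρ
  last-max c≡m = All.zipWith (λ ((_ , a≤m) , a≢c) → ≤∧≢⇒< (subst (_ ≤_) (sym c≡m) a≤m) a≢c)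
                             (ρ-range , Unique-∷ʳ⁻ ρ u)

length-∷ʳ : ∀ xs → length (xs ∷ʳ x) ≡ suc (length xs)
length-∷ʳ xs = trans (length-++ xs) (+-comm (length xs) 1)

last-∷ʳ : ∀ xs → last (xs ∷ʳ x) ≡ just x
last-∷ʳ []           = refl
last-∷ʳ (_ ∷ [])     = refl
last-∷ʳ (_ ∷ y ∷ xs) = last-∷ʳ (y ∷ xs)

≡⇔last-∷ʳ≡just : ∀ xs → x ≡ y ⇔ last (xs ∷ʳ x) ≡ just y
≡⇔last-∷ʳ≡just xs = mk⇔ (λ { refl → last-∷ʳ xs }) (λ eq → just-injective (trans (sym (last-∷ʳ xs)) eq))

isPermᵇ-extend : ∀ σ → T (isPermᵇ σ) → T (isPermᵇ (extend σ))
isPermᵇ-extend σ t =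
  let range , u = isPermᵇ⁻ σ t
  in isPermᵇ⁺ (subst (λ m → All (InRange m) (extend σ)) (sym (length-∷ʳ σ))
                     (All.∷ʳ⁺ (All.map (Product.map₂ m≤n⇒m≤1+n) range) (s≤s z≤n , ≤-refl)))
              (Unique-∷ʳ⁺ u (All.map (λ (_ , a≤m) → <⇒≢ (s≤s a≤m)) range))

∈-words : ∀ n {xs} → All (InRange n) xs → xs ∈ words n (length xs)
∈-words n []                               = here refl
∈-words n {zero  ∷ xs} ((() , _) ∷ _)
∈-words n {suc a ∷ xs} ((_ , a<n) ∷ range) =
  ∈-concatMap⁺ (λ w → map (_∷ w) (applyUpTo suc n))
               (Any.map (λ { refl → ∈-map⁺ (_∷ xs) (∈-applyUpTo⁺ suc a<n) }) (∈-words n range))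

∈-perms : ∀ π → T (isPermᵇ π) → π ∈ perms (length π)
∈-perms π t = ∈-filter⁺ (T? ∘ isPermᵇ) (∈-words _ (proj₁ (isPermᵇ⁻ π t))) t

-- Neither 1243 nor 2143 ends with its maximum.
inClass-∷ʳ-max : ∀ π → All (_< k) π → inClassᵇ (π ∷ʳ k) ≡ inClassᵇ π
inClass-∷ʳ-max π π<k = cong₂ (λ u v → (u ≡ᵇ 0) ∧ (v ≡ᵇ 0))
  (occ-∷ʳ-max (1 ∷ 2 ∷ 4 ∷ []) π π<k λ { (_ ∷ _ ∷ 4<3 ∷ []) → 4≮3 4<3 })
  (occ-∷ʳ-max (2 ∷ 1 ∷ 4 ∷ []) π π<k λ { (_ ∷ _ ∷ 4<3 ∷ []) → 4≮3 4<3 })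
  where
  4≮3 : ¬ 4 < 3
  4≮3 = <-asym (n<1+n 3)

inGᵇ inJᵇ : List ℕ → List ℕ → Bool
inGᵇ σ π = inClassᵇ π ∧ (occ σ π ≡ᵇ 1)
inJᵇ σ π = inClassᵇ π ∧ (occ (extend σ) π ≡ᵇ 0) ∧ (occ σ π ≡ᵇ 1)

inJ⇒inG : ∀ σ π → T (inJᵇ σ π) → T (inGᵇ σ π)
inJ⇒inG σ π t =
  let inClass , rest = ∧-split (inClassᵇ π) t
  in ∧-pair (inClassᵇ π) inClass (proj₂ (∧-split (occ (extend σ) π ≡ᵇ 0) rest))

J≡G-if-last-max : ∀ ρ → All (_< c) ρ → c ≤ length (ρ ∷ʳ c) → ∀ n → Jcoeff (ρ ∷ʳ c) n ≡ Gcoeff (ρ ∷ʳ c) n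
J≡G-if-last-max {c} ρ ρ<c c≤m n = count-cong inJ≡inG (perms n)
  where
  inJ≡inG : ∀ π → inJᵇ (ρ ∷ʳ c) π ≡ inGᵇ (ρ ∷ʳ c) π
  inJ≡inG π with occ (ρ ∷ʳ c) π ≡ᵇ 1 in e
  ... | false = cong (inClassᵇ π ∧_) (∧-zeroʳ _)
  ... | true rewrite unique-occurrence⇒avoids-extension ρ π ρ<c (s≤s c≤m) (≡ᵇ⇒≡ _ 1 (from T-≡ e)) = refl

J<G-if-last-not-max : ∀ ρ → T (isPermᵇ (ρ ∷ʳ c)) → T (inClassᵇ (ρ ∷ʳ c)) → ¬ All (_< c) ρ →
  Jcoeff (ρ ∷ʳ c) (suc (length (ρ ∷ʳ c))) < Gcoeff (ρ ∷ʳ c) (suc (length (ρ ∷ʳ c)))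
J<G-if-last-not-max {c} ρ perm inClass ¬ρ<c = count-< (λ {π} → inJ⇒inG τ π) π₀∈ π₀-in-G π₀-not-in-J
  where
  τ π₀ : List ℕ
  τ = ρ ∷ʳ c
  π₀ = extend τ
  τ<k : All (_< suc (length τ)) τ
  τ<k = All.map (λ (_ , a≤m) → s≤s a≤m) (proj₁ (isPermᵇ⁻ τ perm))
  π₀∈ : π₀ ∈ perms (suc (length τ))
  π₀∈ = subst (λ m → π₀ ∈ perms m) (length-∷ʳ τ) (∈-perms π₀ (isPermᵇ-extend τ perm))
  occ-τ-π₀ : occ τ π₀ ≡ 1
  occ-τ-π₀ = trans (occ-∷ʳ-max ρ τ τ<k ¬ρ<c) (occ-self τ)
  π₀-in-G : T (inGᵇ τ π₀)
  π₀-in-G = subst T (sym (cong₂ (λ u m → u ∧ (m ≡ᵇ 1)) (inClass-∷ʳ-max τ τ<k) occ-τ-π₀))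
                  (∧-pair (inClassᵇ τ) inClass tt)
  π₀-not-in-J : ¬ T (inJᵇ τ π₀)
  π₀-not-in-J t = subst (λ m → T (m ≡ᵇ 0)) (occ-self π₀)
                        (proj₁ (∧-split (occ π₀ π₀ ≡ᵇ 0) (proj₂ (∧-split (inClassᵇ π₀) t))))

J≡G⇔last-max : ∀ ρ → T (isPermᵇ (ρ ∷ʳ c)) → T (inClassᵇ (ρ ∷ʳ c)) →
  (∀ n → Jcoeff (ρ ∷ʳ c) n ≡ Gcoeff (ρ ∷ʳ c) n) ⇔ All (_< c) ρ
J≡G⇔last-max {c} ρ perm inClass = mk⇔ last-max (λ ρ<c → J≡G-if-last-max ρ ρ<c c≤m)
  where
  c≤m : c ≤ length (ρ ∷ʳ c)
  c≤m = proj₂ (proj₂ (All.∷ʳ⁻ (proj₁ (isPermᵇ⁻ (ρ ∷ʳ c) perm))))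
  last-max : (∀ n → Jcoeff (ρ ∷ʳ c) n ≡ Gcoeff (ρ ∷ʳ c) n) → All (_< c) ρ
  last-max J≡G with all? (_<? c) ρ
  ... | yes ρ<c = ρ<c
  ... | no ¬ρ<c = contradiction (J≡G (suc (length (ρ ∷ʳ c)))) (<⇒≢ (J<G-if-last-not-max ρ perm inClass ¬ρ<c))

proposition8p3 : (τ : List ℕ) → T (isPermᵇ τ ∧ inClassᵇ τ) → length τ ≥ 1 →
    ((∀ (n : ℕ) → Jcoeff τ n ≡ Gcoeff τ n) ⇔ (last τ ≡ just (length τ)))
proposition8p3 τ h len with initLast τ | ∧-split (isPermᵇ τ) h
... | []      | _              = contradiction len λ ()
... | ρ ∷ʳ′ c | perm , inClass =
  ≡⇔last-∷ʳ≡just ρ ⇔-∘ (last-max⇔last≡length ρ (isPermᵇ⁻ _ perm) ⇔-∘ J≡G⇔last-max ρ perm inClass)
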